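{- Let $t$ be a rooted tree with $n$ vertices. The number of leaf tubings of $t$ equals the number of decreasing labellings of $t$.
   Context: A tube of $t$ is a set of vertices inducing a connected subgraph; a binary tubing $\tau$ of $t$ is a set of tubes containing $V(t)$ such that each tube is a single vertex or is partitioned by two other tubes of $\tau$. A leaf tubing is a binary tubing in which every tube of size at least $2$ is partitioned into a single vertex that is a leaf of the tree induced by that tube, and the rest of the tube. A decreasing labelling of $t$ is a bijective labelling of its vertices by $1,\dots,n$ in which every child has a smaller label than its parent. -}

module Defs where

open import Level using (0ℓ)
open import Data.Nat using (ℕ; zero; suc; _≥_)
open import Data.Fin using (Fin) renaming (_<_ to _<ᶠ_)
open import Data.Fin.Subset using (Subset; ⊤; ⁅_⁆; _∩_; _∪_; _-_; ∣_∣; Nonempty; Empty; _⊆_)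
  renaming (_∈_ to _∈ˢ_)
open import Data.List using (List)
open import Data.List.Membership.Propositional using () renaming (_∈_ to _∈ᴸ_)
open import Data.Product using (Σ; ∃; ∃-syntax; _×_; _,_; proj₁; proj₂)
open import Data.Sum using (_⊎_)
open import Relation.Nullary using (¬_)
open import Relation.Binary.PropositionalEquality using (_≡_; _≢_; refl; sym; trans)
open import Relation.Binary.Bundles using (Setoid)
open import Function.Definitions using (Bijective)

iter : ∀ {A : Set} → ℕ → (A → A) → A → A
iter zero    f x = x
iter (suc k) f x = f (iter k f x)

-- A rooted tree with vertex set Fin n: a root and a parent map
-- (the root is its own parent); every vertex reaches the root by
-- following parents (this forces acyclicity, so the graph with edges
-- {v , parent v} (v ≠ root) is a tree rooted at root).
record RootedTree (n : ℕ) : Set where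
  field
    root        : Fin n
    parent      : Fin n → Fin n
    parent-root : parent root ≡ root
    reaches     : ∀ v → iter n parent v ≡ root

module _ {n : ℕ} (t : RootedTree n) where
  open RootedTree t

  Child : Fin n → Fin n → Set
  Child w v = w ≢ root × parent w ≡ v

  Adjacent : Fin n → Fin n → Set
  Adjacent u v = Child u v ⊎ Child v u

  data WalkIn (S : Subset n) : Fin n → Fin n → Set where
    here : ∀ {u} → u ∈ˢ S → WalkIn S u u
    step : ∀ {u w v} → u ∈ˢ S → Adjacent u w → WalkIn S w v → WalkIn S u v

  Connected : Subset n → Set
  Connected S = ∀ u v → u ∈ˢ S → v ∈ˢ S → WalkIn S u v

  Tube : Subset n → Set
  Tube S = Nonempty S × Connected S

  Compatible : Subset n → Subset n → Set
  Compatible A B = A ⊆ B ⊎ B ⊆ A ⊎ Empty (A ∩ B)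

  PartitionedBy : Subset n → Subset n → Subset n → Set
  PartitionedBy S A B = Empty (A ∩ B) × (A ∪ B) ≡ S

  -- binary tubing (a set of tubes, represented by a list)
  record IsBinaryTubing (τ : List (Subset n)) : Set where
    field
      tubes      : ∀ S → S ∈ᴸ τ → Tube S
      compatible : ∀ A B → A ∈ᴸ τ → B ∈ᴸ τ → Compatible A B
      hasV       : ⊤ ∈ᴸ τ
      binary     : ∀ S → S ∈ᴸ τ →
                   (∣ S ∣ ≡ 1) ⊎
                   (∃[ A ] ∃[ B ] (A ∈ᴸ τ × B ∈ᴸ τ × A ≢ S × B ≢ S × PartitionedBy S A B))

  LeafOf : Subset n → Fin n → Set
  LeafOf S v = v ∈ˢ S × (∀ w → w ∈ˢ S → ¬ Child w v)

  record IsLeafTubing (τ : List (Subset n)) : Set where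
    field
      isBinary : IsBinaryTubing τ
      leafy    : ∀ S → S ∈ᴸ τ → ∣ S ∣ ≥ 2 →
                 ∃[ v ] (LeafOf S v × ⁅ v ⁆ ∈ᴸ τ × (S - v) ∈ᴸ τ)

  LeafTubings : Setoid 0ℓ 0ℓ
  LeafTubings = record
    { Carrier = Σ (List (Subset n)) IsLeafTubing
    ; _≈_ = λ x y → ∀ S → (S ∈ᴸ proj₁ x → S ∈ᴸ proj₁ y) × (S ∈ᴸ proj₁ y → S ∈ᴸ proj₁ x)
    ; isEquivalence = record
      { refl  = λ S → (λ p → p) , (λ p → p)
      ; sym   = λ e S → proj₂ (e S) , proj₁ (e S)
      ; trans = λ e f S → (λ p → proj₁ (f S) (proj₁ (e S) p)) , (λ p → proj₂ (e S) (proj₂ (f S) p))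
      }
    }

  -- decreasing labelling: bijection Fin n → Fin n (labels 0..n-1 stand for 1..n)
  -- with every child labelled smaller than its parent
  IsDecreasing : (Fin n → Fin n) → Set
  IsDecreasing ℓ = Bijective _≡_ _≡_ ℓ × (∀ w v → Child w v → ℓ w <ᶠ ℓ v)

  DecreasingLabellings : Setoid 0ℓ 0ℓ
  DecreasingLabellings = record
    { Carrier = Σ (Fin n → Fin n) IsDecreasing
    ; _≈_ = λ x y → ∀ v → proj₁ x v ≡ proj₁ y v
    ; isEquivalence = record
      { refl  = λ v → refl
      ; sym   = λ e v → sym (e v)
      ; trans = λ e f v → trans (e v) (f v)
      }
    }

{-# OPTIONS --safe #-}
module Submission where

-- A leaf tubing of a tree on n vertices is a chain V = S₀ ⊃ S₁ ⊃ … ⊃ S_{n-1} of tubes, each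
-- obtained from the previous one by deleting a leaf, together with all singletons. Labelling the
-- leaf deleted at step k by k is decreasing, because a vertex becomes a leaf only after its
-- children are gone; conversely a decreasing labelling ℓ gives the chain of superlevel sets
-- {v | k ≤ ℓ v}. The chain is determined by the tubing: if two distinct leaves v, v′ of a tube S
-- could both be deleted, the tubes S - v and S - v′ would be neither nested nor disjoint.

open import Defs
open import Data.Bool using (Bool; T)
open import Data.Bool.Properties using (T-≡)
open import Data.Empty using (⊥; ⊥-elim)
open import Data.Fin using (Fin; zero; suc; _≟_; toℕ; fromℕ<) renaming (_<_ to _<ᶠ_)
open import Data.Fin.Properties using (toℕ-fromℕ<; toℕ-injective; toℕ<n; toℕ≤pred[n])
open import Data.Fin.Subset
  using (Subset; ⊤; ⁅_⁆; _∩_; _∪_; _-_; ∣_∣; Nonempty; Empty; _⊆_; _∈_; _∉_; inside; outside)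
open import Data.Fin.Subset.Properties
  using (_∈?_; ∈⊤; ⊆-antisym; x∈⁅x⁆; x∈⁅y⁆⇒x≡y; x∈p∩q⁺; x∈p∩q⁻; x∈p∪q⁺; x∈p∪q⁻;
         ∣⁅x⁆∣≡1; ∣⊤∣≡n; p─⊥≡p; p─q⊆p; x∈p∧x≢y⇒x∈p-y; x∈p⇒∣p-x∣<∣p∣)
open import Data.Nat using (ℕ; zero; suc; _+_; _≤_; _<_; _≥_; z≤n; s≤s; _≤?_; _<?_; _≤ᵇ_)
open import Data.Nat.Properties
  using (≤-refl; ≤-trans; <-≤-trans; ≤-antisym; <⇒≤; ≤-pred; n≤1+n; m<n⇒m<1+n; 1+n≰n; ≤-total; n≮0; ≮⇒≥;
         m≤n⇒m<n∨m≡n; n≮n; ≤∧≢⇒<; ≰⇒>; m≤n+m; +-identityʳ; +-suc; +-cancelʳ-≡; +-cancelʳ-≤;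
         suc-injective; ≤ᵇ⇒≤; ≤⇒≤ᵇ)
open import Data.List using (List; map; _++_; allFin)
open import Data.List.Properties using (map-cong)
open import Data.List.Membership.Propositional using () renaming (_∈_ to _∈ᴸ_)
open import Data.List.Membership.Propositional.Properties
  using (∈-map⁺; ∈-map⁻; ∈-++⁺ˡ; ∈-++⁺ʳ; ∈-++⁻; ∈-allFin)
open import Data.Product using (Σ; ∃-syntax; _×_; _,_; proj₁; proj₂)
open import Data.Sum using (_⊎_; inj₁; inj₂; [_,_]; map₁; swap)
open import Data.Vec using (_∷_; here; there; tabulate)
open import Data.Vec.Properties using (tabulate-cong; lookup∘tabulate; []=⇒lookup; lookup⇒[]=)
open import Function.Bundles using (Bijection; Equivalence; Inverse)
open import Function.Definitions using (Inverseˡ; Inverseʳ)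
open import Function.Properties.Inverse using (Inverse⇒Bijection)
open import Function.Consequences.Propositional
  using (inverseᵇ⇒bijective; strictlyInverseˡ⇒inverseˡ; strictlyInverseʳ⇒inverseʳ)
open import Relation.Binary.Bundles using (Setoid)
open import Relation.Binary.PropositionalEquality
  using (_≡_; _≢_; refl; sym; trans; cong; subst; module ≡-Reasoning)
open import Relation.Nullary using (¬_; yes; no; contradiction; Dec)

iter-fixedPoint : ∀ {A : Set} (f : A → A) {x} k → f x ≡ x → iter k f x ≡ x
iter-fixedPoint f zero    fx≡x = refl
iter-fixedPoint f (suc k) fx≡x = trans (cong f (iter-fixedPoint f k fx≡x)) fx≡x

iter-suc : ∀ {A : Set} (f : A → A) k x → iter (suc k) f x ≡ iter k f (f x)
iter-suc f zero    x = refl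
iter-suc f (suc k) x = cong f (iter-suc f k x)

x∉p-x : ∀ {n} (p : Subset n) x → x ∉ p - x
x∉p-x (s ∷ p) zero    ()
x∉p-x (s ∷ p) (suc x) (there x∈p-x) = x∉p-x p x x∈p-x

x∈p-y⇒x≢y : ∀ {n} {p : Subset n} {x y} → x ∈ p - y → x ≢ y
x∈p-y⇒x≢y {p = p} x∈p-x refl = x∉p-x p _ x∈p-x

x∈p⇒∣p∣≡1+∣p-x∣ : ∀ {n} {p : Subset n} {x} → x ∈ p → ∣ p ∣ ≡ suc ∣ p - x ∣
x∈p⇒∣p∣≡1+∣p-x∣ {p = inside  ∷ p} here        = cong suc (cong ∣_∣ (sym (p─⊥≡p p)))
x∈p⇒∣p∣≡1+∣p-x∣ {p = inside  ∷ p} (there x∈p) = cong suc (x∈p⇒∣p∣≡1+∣p-x∣ x∈p)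
x∈p⇒∣p∣≡1+∣p-x∣ {p = outside ∷ p} (there x∈p) = x∈p⇒∣p∣≡1+∣p-x∣ x∈p

x∈p⇒x≡y⊎x∈p-y : ∀ {n} {p : Subset n} {x} y → x ∈ p → x ≡ y ⊎ x ∈ p - y
x∈p⇒x≡y⊎x∈p-y {x = x} y x∈p with x ≟ y
... | yes x≡y = inj₁ x≡y
... | no  x≢y = inj₂ (x∈p∧x≢y⇒x∈p-y x∈p x≢y)

p⊆⁅x⁆⇒p≡⁅x⁆ : ∀ {n} {p : Subset n} {x} → Nonempty p → p ⊆ ⁅ x ⁆ → p ≡ ⁅ x ⁆
p⊆⁅x⁆⇒p≡⁅x⁆ {p = p} {x} (y , y∈p) p⊆⁅x⁆ = ⊆-antisym p⊆⁅x⁆ λ z∈⁅x⁆ →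
  subst (_∈ p) (trans (x∈⁅y⁆⇒x≡y x (p⊆⁅x⁆ y∈p)) (sym (x∈⁅y⁆⇒x≡y x z∈⁅x⁆))) y∈p

∣p∣≡1⇒p≡⁅x⁆ : ∀ {n} {p : Subset n} {x} → ∣ p ∣ ≡ 1 → x ∈ p → p ≡ ⁅ x ⁆
∣p∣≡1⇒p≡⁅x⁆ {p = p} {x} ∣p∣≡1 x∈p = p⊆⁅x⁆⇒p≡⁅x⁆ (x , x∈p) p⊆⁅x⁆
  where
  ∣p-x∣≡0 : ∣ p - x ∣ ≡ 0
  ∣p-x∣≡0 = suc-injective (trans (sym (x∈p⇒∣p∣≡1+∣p-x∣ x∈p)) ∣p∣≡1)

  p⊆⁅x⁆ : p ⊆ ⁅ x ⁆
  p⊆⁅x⁆ {y} y∈p = [ (λ { refl → x∈⁅x⁆ x })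
                  , (λ y∈p-x →
                      contradiction (subst (∣ p - x - y ∣ <_) ∣p-x∣≡0 (x∈p⇒∣p-x∣<∣p∣ y∈p-x)) n≮0)
                  ] (x∈p⇒x≡y⊎x∈p-y x y∈p)

Empty[⁅x⁆∩p-x] : ∀ {n} (p : Subset n) x → Empty (⁅ x ⁆ ∩ (p - x))
Empty[⁅x⁆∩p-x] p x (y , y∈⁅x⁆∩p-x) with x∈p∩q⁻ _ _ y∈⁅x⁆∩p-x
... | y∈⁅x⁆ , y∈p-x = x∈p-y⇒x≢y y∈p-x (x∈⁅y⁆⇒x≡y x y∈⁅x⁆)

x∈p⇒⁅x⁆∪p-x≡p : ∀ {n} {p : Subset n} {x} → x ∈ p → ⁅ x ⁆ ∪ (p - x) ≡ p
x∈p⇒⁅x⁆∪p-x≡p {p = p} {x} x∈p = ⊆-antisym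
  (λ y∈∪ → [ (λ y∈⁅x⁆ → subst (_∈ p) (sym (x∈⁅y⁆⇒x≡y x y∈⁅x⁆)) x∈p) , p─q⊆p p _ ]
             (x∈p∪q⁻ _ _ y∈∪))
  λ y∈p → x∈p∪q⁺ (map₁ (λ { refl → x∈⁅x⁆ x }) (x∈p⇒x≡y⊎x∈p-y x y∈p))

y∈p∧y∉⁅x⁆⇒⁅x⁆≢p : ∀ {n} {p : Subset n} {x y} → y ∈ p → y ∉ ⁅ x ⁆ → ⁅ x ⁆ ≢ p
y∈p∧y∉⁅x⁆⇒⁅x⁆≢p y∈p y∉⁅x⁆ refl = y∉⁅x⁆ y∈p

x∈p⇒p-x≢p : ∀ {n} {p : Subset n} {x} → x ∈ p → p - x ≢ p
x∈p⇒p-x≢p {p = p} {x} x∈p p-x≡p = x∉p-x p x (subst (x ∈_) (sym p-x≡p) x∈p)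

p-x⊆q⊆p⇒q≡p⊎q≡p-x : ∀ {n} {p q : Subset n} {x} → p - x ⊆ q → q ⊆ p → q ≡ p ⊎ q ≡ p - x
p-x⊆q⊆p⇒q≡p⊎q≡p-x {p = p} {q} {x} p-x⊆q q⊆p with x ∈? q
... | yes x∈q = inj₁ (⊆-antisym q⊆p p⊆q)
  where
  p⊆q : p ⊆ q
  p⊆q y∈p = [ (λ { refl → x∈q }) , p-x⊆q ] (x∈p⇒x≡y⊎x∈p-y x y∈p)
... | no  x∉q = inj₂ (⊆-antisym (λ y∈q → x∈p∧x≢y⇒x∈p-y (q⊆p y∈q) λ { refl → x∉q y∈q }) p-x⊆q)

q⊆p∧Empty[q∩p-x]⇒q≡⁅x⁆ : ∀ {n} {p q : Subset n} {x} →
                    Nonempty q → q ⊆ p → Empty (q ∩ (p - x)) → q ≡ ⁅ x ⁆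
q⊆p∧Empty[q∩p-x]⇒q≡⁅x⁆ {p = p} {q} {x} q≠∅ q⊆p q∩p-x≡∅ = p⊆⁅x⁆⇒p≡⁅x⁆ q≠∅ q⊆⁅x⁆
  where
  q⊆⁅x⁆ : q ⊆ ⁅ x ⁆
  q⊆⁅x⁆ {y} y∈q = [ (λ { refl → x∈⁅x⁆ x }) , (λ y∈p-x → ⊥-elim (q∩p-x≡∅ (y , x∈p∩q⁺ (y∈q , y∈p-x)))) ]
                    (x∈p⇒x≡y⊎x∈p-y x (q⊆p y∈q))

∈-tabulate⁺ : ∀ {n} {f : Fin n → Bool} {v} → T (f v) → v ∈ tabulate f
∈-tabulate⁺ {f = f} {v} Tfv = lookup⇒[]= v _ (trans (lookup∘tabulate f v) (Equivalence.to T-≡ Tfv))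

∈-tabulate⁻ : ∀ {n} {f : Fin n → Bool} {v} → v ∈ tabulate f → T (f v)
∈-tabulate⁻ {f = f} {v} v∈ = Equivalence.from T-≡ (trans (sym (lookup∘tabulate f v)) ([]=⇒lookup v∈))

module _ {n : ℕ} (t : RootedTree n) where
  open RootedTree t

  Child-irreflexive : ∀ v → ¬ Child t v v
  Child-irreflexive v (v≢root , parent-v≡v) =
    v≢root (trans (sym (iter-fixedPoint parent n parent-v≡v)) (reaches v))

  walk-start : ∀ {S u v} → WalkIn t S u v → u ∈ S
  walk-start (here u∈S)     = u∈S
  walk-start (step u∈S _ _) = u∈S

  walk-trans : ∀ {S u v w} → WalkIn t S u v → WalkIn t S v w → WalkIn t S u w
  walk-trans (here _)             q = q
  walk-trans (step u∈S u~w′ p) q = step u∈S u~w′ (walk-trans p q)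

  walk-sym : ∀ {S u v} → WalkIn t S u v → WalkIn t S v u
  walk-sym (here u∈S)          = here u∈S
  walk-sym (step u∈S u~w p) =
    walk-trans (walk-sym p) (step (walk-start p) (swap u~w) (here u∈S))

  UpClosed : Subset n → Set
  UpClosed S = ∀ v → v ∈ S → v ≢ root → parent v ∈ S

  UpClosed⇒Connected : ∀ {S} → UpClosed S → Connected t S
  UpClosed⇒Connected {S} up u v u∈S v∈S =
    walk-trans (toRoot n u u∈S (reaches u)) (walk-sym (toRoot n v v∈S (reaches v)))
    where
    toRoot : ∀ k v → v ∈ S → iter k parent v ≡ root → WalkIn t S v root
    toRoot zero    v v∈S refl = here v∈S
    toRoot (suc k) v v∈S reach with v ≟ root
    ... | yes refl   = here v∈S
    ... | no  v≢root = step v∈S (inj₁ (v≢root , refl))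
      (toRoot k (parent v) (up v v∈S v≢root) (trans (sym (iter-suc parent k v)) reach))

  ⁅x⁆-connected : ∀ x → Connected t ⁅ x ⁆
  ⁅x⁆-connected x u v u∈⁅x⁆ v∈⁅x⁆
    rewrite x∈⁅y⁆⇒x≡y x u∈⁅x⁆ | x∈⁅y⁆⇒x≡y x v∈⁅x⁆ = here (x∈⁅x⁆ x)

  Compatible-sym : ∀ {A B} → Compatible t A B → Compatible t B A
  Compatible-sym (inj₁ A⊆B)        = inj₂ (inj₁ A⊆B)
  Compatible-sym (inj₂ (inj₁ B⊆A)) = inj₁ B⊆A
  Compatible-sym (inj₂ (inj₂ A∩B≡∅)) = inj₂ (inj₂ λ (x , x∈B∩A) →
    let x∈B , x∈A = x∈p∩q⁻ _ _ x∈B∩A in A∩B≡∅ (x , x∈p∩q⁺ (x∈A , x∈B)))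

  ⁅x⁆-compatible : ∀ x A → Compatible t ⁅ x ⁆ A
  ⁅x⁆-compatible x A with x ∈? A
  ... | yes x∈A = inj₁ λ y∈⁅x⁆ → subst (_∈ A) (sym (x∈⁅y⁆⇒x≡y x y∈⁅x⁆)) x∈A
  ... | no  x∉A = inj₂ (inj₂ λ (y , y∈⁅x⁆∩A) →
    let y∈⁅x⁆ , y∈A = x∈p∩q⁻ _ _ y∈⁅x⁆∩A in x∉A (subst (_∈ A) (x∈⁅y⁆⇒x≡y x y∈⁅x⁆) y∈A))

  -- S - v and S - v′ are not nested, so they are disjoint; yet the neighbour of v on a
  -- walk to v′ lies in both, unless it is v′ itself and one of v, v′ is a child of the other.
  leaf-unique : ∀ {S v v′} → Connected t S → Compatible t (S - v) (S - v′) →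
                LeafOf t S v → LeafOf t S v′ → v ≡ v′
  leaf-unique {S} {v} {v′} conn compat (v∈S , v-leaf) (v′∈S , v′-leaf) with v ≟ v′
  ... | yes v≡v′ = v≡v′
  ... | no  v≢v′ with compat
  ...   | inj₁ S-v⊆S-v′ =
            ⊥-elim (x∉p-x S v′ (S-v⊆S-v′ (x∈p∧x≢y⇒x∈p-y v′∈S (λ v′≡v → v≢v′ (sym v′≡v)))))
  ...   | inj₂ (inj₁ S-v′⊆S-v) = ⊥-elim (x∉p-x S v (S-v′⊆S-v (x∈p∧x≢y⇒x∈p-y v∈S v≢v′)))
  ...   | inj₂ (inj₂ disjoint) = ⊥-elim (firstStep (conn v v′ v∈S v′∈S))
    where
    firstStep : WalkIn t S v v′ → ⊥
    firstStep (here _) = v≢v′ refl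
    firstStep (step {w = w} _ v~w walk) with w ≟ v′
    ... | yes refl = [ v′-leaf v v∈S , v-leaf v′ v′∈S ] v~w
    ... | no  w≢v′ = disjoint (w , x∈p∩q⁺
            ( x∈p∧x≢y⇒x∈p-y (walk-start walk)
                (λ { refl → [ Child-irreflexive w , Child-irreflexive w ] v~w })
            , x∈p∧x≢y⇒x∈p-y (walk-start walk) w≢v′))

opaque
  superlevel : ∀ {n} → (Fin n → Fin n) → ℕ → Subset n
  superlevel ℓ k = tabulate (λ v → k ≤ᵇ toℕ (ℓ v))

  ∈-superlevel⁺ : ∀ {n} {ℓ : Fin n → Fin n} {k v} → k ≤ toℕ (ℓ v) → v ∈ superlevel ℓ k
  ∈-superlevel⁺ k≤ℓv = ∈-tabulate⁺ (≤⇒≤ᵇ k≤ℓv)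

  ∈-superlevel⁻ : ∀ {n} {ℓ : Fin n → Fin n} {k v} → v ∈ superlevel ℓ k → k ≤ toℕ (ℓ v)
  ∈-superlevel⁻ v∈ = ≤ᵇ⇒≤ _ _ (∈-tabulate⁻ v∈)

  superlevel-cong : ∀ {n} {ℓ ℓ′ : Fin n → Fin n} → (∀ v → ℓ v ≡ ℓ′ v) →
                    ∀ k → superlevel ℓ k ≡ superlevel ℓ′ k
  superlevel-cong ℓ≗ℓ′ k = tabulate-cong (λ v → cong (λ j → k ≤ᵇ toℕ j) (ℓ≗ℓ′ v))

tubingOf : ∀ {n} → (Fin n → Fin n) → List (Subset n)
tubingOf {n} ℓ = map (λ i → superlevel ℓ (toℕ i)) (allFin n) ++ map ⁅_⁆ (allFin n)

module _ {n} {ℓ : Fin n → Fin n} where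

  superlevel∈tubingOf : ∀ {k} → k < n → superlevel ℓ k ∈ᴸ tubingOf ℓ
  superlevel∈tubingOf k<n = ∈-++⁺ˡ (subst (_∈ᴸ _) (cong (superlevel ℓ) (toℕ-fromℕ< k<n))
    (∈-map⁺ (λ i → superlevel ℓ (toℕ i)) (∈-allFin (fromℕ< k<n))))

  ⁅v⁆∈tubingOf : ∀ v → ⁅ v ⁆ ∈ᴸ tubingOf ℓ
  ⁅v⁆∈tubingOf v = ∈-++⁺ʳ (map (λ i → superlevel ℓ (toℕ i)) (allFin n)) (∈-map⁺ ⁅_⁆ (∈-allFin v))

  ∈tubingOf⁻ : ∀ {X} → X ∈ᴸ tubingOf ℓ → (∃[ k ] k < n × X ≡ superlevel ℓ k) ⊎ (∃[ v ] X ≡ ⁅ v ⁆)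
  ∈tubingOf⁻ X∈ with ∈-++⁻ (map (λ i → superlevel ℓ (toℕ i)) (allFin n)) X∈
  ... | inj₁ X∈superlevels = let i , _ , X≡ = ∈-map⁻ (λ i → superlevel ℓ (toℕ i)) X∈superlevels
                             in inj₁ (toℕ i , toℕ<n i , X≡)
  ... | inj₂ X∈singletons  = let v , _ , X≡ = ∈-map⁻ ⁅_⁆ X∈singletons in inj₂ (v , X≡)

tubingOf-cong : ∀ {n} {ℓ ℓ′ : Fin n → Fin n} → (∀ v → ℓ v ≡ ℓ′ v) → tubingOf ℓ ≡ tubingOf ℓ′
tubingOf-cong {n} ℓ≗ℓ′ =
  cong (_++ map ⁅_⁆ (allFin n)) (map-cong (λ i → superlevel-cong ℓ≗ℓ′ (toℕ i)) (allFin n))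

module FromLeafTubing {m : ℕ} (t : RootedTree (suc m)) (τ : List (Subset (suc m)))
                      (isLeafTubing : IsLeafTubing t τ) where
  open IsLeafTubing isLeafTubing
  open IsBinaryTubing isBinary

  N : ℕ
  N = suc m

  record LeafRemoval (X Y : Subset N) : Set where
    field
      vertex      : Fin N
      isLeaf      : LeafOf t X vertex
      singleton∈τ : ⁅ vertex ⁆ ∈ᴸ τ
      remainder   : Y ≡ X - vertex

  -- Once a single vertex is left, the chain stays constant.
  shrink : (X : Subset N) → X ∈ᴸ τ → Dec (2 ≤ ∣ X ∣) → Σ (Subset N) (_∈ᴸ τ)
  shrink X X∈τ (yes 2≤∣X∣) = let u , _ , _ , X-u∈τ = leafy X X∈τ 2≤∣X∣ in X - u , X-u∈τ
  shrink X X∈τ (no  _)     = X , X∈τ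

  shrink-removesLeaf : ∀ X X∈τ d → 2 ≤ ∣ X ∣ → LeafRemoval X (proj₁ (shrink X X∈τ d))
  shrink-removesLeaf X X∈τ (yes 2≤∣X∣) _ =
    let u , u-leaf , ⁅u⁆∈τ , _ = leafy X X∈τ 2≤∣X∣ in record
      { vertex = u ; isLeaf = u-leaf ; singleton∈τ = ⁅u⁆∈τ ; remainder = refl }
  shrink-removesLeaf X X∈τ (no 2≰∣X∣) 2≤∣X∣ = contradiction 2≤∣X∣ 2≰∣X∣

  shrink-⊆ : ∀ X X∈τ d → proj₁ (shrink X X∈τ d) ⊆ X
  shrink-⊆ X X∈τ (yes _) = p─q⊆p X _
  shrink-⊆ X X∈τ (no  _) x∈X = x∈X

  chain : ℕ → Σ (Subset N) (_∈ᴸ τ)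
  chain zero    = ⊤ , hasV
  chain (suc k) = let X , X∈τ = chain k in shrink X X∈τ (2 ≤? ∣ X ∣)

  S : ℕ → Subset N
  S k = proj₁ (chain k)

  S∈τ : ∀ k → S k ∈ᴸ τ
  S∈τ k = proj₂ (chain k)

  S-suc⊆S : ∀ k → S (suc k) ⊆ S k
  S-suc⊆S k = shrink-⊆ (S k) (S∈τ k) (2 ≤? ∣ S k ∣)

  S-antitone : ∀ {j k} → j ≤ k → S k ⊆ S j
  S-antitone {k = zero}  z≤n v∈S = v∈S
  S-antitone {k = suc k} j≤1+k v∈S with m≤n⇒m<n∨m≡n j≤1+k
  ... | inj₁ j<1+k = S-antitone (≤-pred j<1+k) (S-suc⊆S k v∈S)
  ... | inj₂ refl  = v∈S

  ∣S∣+k≡N : ∀ k → k ≤ m → ∣ S k ∣ + k ≡ N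
  2≤∣S∣ : ∀ k → k < m → 2 ≤ ∣ S k ∣

  removal : ∀ k → k < m → LeafRemoval (S k) (S (suc k))
  removal k k<m = shrink-removesLeaf (S k) (S∈τ k) (2 ≤? ∣ S k ∣) (2≤∣S∣ k k<m)

  ∣S∣+k≡N zero    _   = trans (+-identityʳ _) (∣⊤∣≡n N)
  ∣S∣+k≡N (suc k) k<m = begin
    ∣ S (suc k) ∣ + suc k  ≡⟨ +-suc _ k ⟩
    suc ∣ S (suc k) ∣ + k  ≡⟨ cong (λ X → suc ∣ X ∣ + k) remainder ⟩
    suc ∣ S k - vertex ∣ + k ≡⟨ cong (_+ k) (sym (x∈p⇒∣p∣≡1+∣p-x∣ (proj₁ isLeaf))) ⟩
    ∣ S k ∣ + k            ≡⟨ ∣S∣+k≡N k (<⇒≤ k<m) ⟩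
    N                      ∎
    where
    open LeafRemoval (removal k k<m)
    open ≡-Reasoning

  2≤∣S∣ k k<m = +-cancelʳ-≤ k 2 ∣ S k ∣ (subst (2 + k ≤_) (sym (∣S∣+k≡N k (<⇒≤ k<m))) (s≤s k<m))

  ∣S∣≡1 : ∀ k → k ≤ m → ¬ k < m → ∣ S k ∣ ≡ 1
  ∣S∣≡1 k k≤m k≮m with ≤-antisym k≤m (≮⇒≥ k≮m)
  ... | refl = +-cancelʳ-≡ k ∣ S k ∣ 1 (∣S∣+k≡N k k≤m)

  -- The last stage S m = ⁅ v ⁆ is never emptied; v counts as removed at step m.
  RemovedAt : Fin N → Fin N → Set
  RemovedAt v i = v ∈ S (toℕ i) × (toℕ i < m → v ∉ S (suc (toℕ i)))

  element : ℕ → Fin N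
  element k = proj₁ (proj₁ (tubes (S k) (S∈τ k)))

  element-∈ : ∀ k → element k ∈ S k
  element-∈ k = proj₂ (proj₁ (tubes (S k) (S∈τ k)))

  lastStage≡⁅element⁆ : ∀ k → k ≤ m → ¬ k < m → S k ≡ ⁅ element k ⁆
  lastStage≡⁅element⁆ k k≤m k≮m = ∣p∣≡1⇒p≡⁅x⁆ (∣S∣≡1 k k≤m k≮m) (element-∈ k)

  vertexAt : Fin N → Fin N
  vertexAt i with toℕ i <? m
  ... | yes i<m = LeafRemoval.vertex (removal (toℕ i) i<m)
  ... | no  _   = element (toℕ i)

  vertexAt-leaf : ∀ i → LeafOf t (S (toℕ i)) (vertexAt i)
  vertexAt-leaf i with toℕ i <? m
  ... | yes i<m = LeafRemoval.isLeaf (removal (toℕ i) i<m)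
  ... | no  i≮m = element-∈ (toℕ i) , λ w w∈S w-child →
        Child-irreflexive t w (subst (Child t w) (sym (x∈⁅y⁆⇒x≡y _ (subst (w ∈_) S≡⁅x⁆ w∈S))) w-child)
    where
    S≡⁅x⁆ : S (toℕ i) ≡ ⁅ element (toℕ i) ⁆
    S≡⁅x⁆ = lastStage≡⁅element⁆ (toℕ i) (toℕ≤pred[n] i) i≮m

  ⁅vertexAt⁆∈τ : ∀ i → ⁅ vertexAt i ⁆ ∈ᴸ τ
  ⁅vertexAt⁆∈τ i with toℕ i <? m
  ... | yes i<m = LeafRemoval.singleton∈τ (removal (toℕ i) i<m)
  ... | no  i≮m = subst (_∈ᴸ τ) (lastStage≡⁅element⁆ (toℕ i) (toℕ≤pred[n] i) i≮m) (S∈τ (toℕ i))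

  vertexAt-removedAt : ∀ i → RemovedAt (vertexAt i) i
  vertexAt-removedAt i = proj₁ (vertexAt-leaf i) , removed
    where
    removed : toℕ i < m → vertexAt i ∉ S (suc (toℕ i))
    removed i<m′ with toℕ i <? m
    ... | yes i<m = λ u∈S-suc → x∉p-x (S (toℕ i)) vertex (subst (vertex ∈_) remainder u∈S-suc)
      where open LeafRemoval (removal (toℕ i) i<m)
    ... | no  i≮m = contradiction i<m′ i≮m

  removedAt-unique : ∀ {v} i → RemovedAt v i → v ≡ vertexAt i
  removedAt-unique {v} i (v∈S , v∉S-suc) with toℕ i <? m
  ... | yes i<m = [ (λ v≡u → v≡u)
                  , (λ v∈S-u → contradiction (subst (v ∈_) (sym remainder) v∈S-u) (v∉S-suc i<m))
                  ] (x∈p⇒x≡y⊎x∈p-y vertex v∈S)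
    where open LeafRemoval (removal (toℕ i) i<m)
  ... | no  i≮m =
    x∈⁅y⁆⇒x≡y _ (subst (v ∈_) (lastStage≡⁅element⁆ (toℕ i) (toℕ≤pred[n] i) i≮m) v∈S)

  -- level v j is the last index k ≤ j with v ∈ S k.
  level : Fin N → ℕ → ℕ
  level v zero    = zero
  level v (suc j) with v ∈? S (suc j)
  ... | yes _ = suc j
  ... | no  _ = level v j

  level-≤ : ∀ v j → level v j ≤ j
  level-≤ v zero    = z≤n
  level-≤ v (suc j) with v ∈? S (suc j)
  ... | yes _ = ≤-refl
  ... | no  _ = ≤-trans (level-≤ v j) (n≤1+n j)

  ∈S-level : ∀ v j → v ∈ S (level v j)
  ∈S-level v zero    = ∈⊤
  ∈S-level v (suc j) with v ∈? S (suc j)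
  ... | yes v∈S = v∈S
  ... | no  _   = ∈S-level v j

  ∈S⇒≤level : ∀ v {k} j → k ≤ j → v ∈ S k → k ≤ level v j
  ∈S⇒≤level v zero    z≤n   _   = z≤n
  ∈S⇒≤level v (suc j) k≤1+j v∈S with v ∈? S (suc j)
  ... | yes _     = k≤1+j
  ... | no  v∉S-j with m≤n⇒m<n∨m≡n k≤1+j
  ...   | inj₁ k<1+j = ∈S⇒≤level v j (≤-pred k<1+j) v∈S
  ...   | inj₂ refl  = contradiction v∈S v∉S-j

  label : Fin N → Fin N
  label v = fromℕ< (s≤s (level-≤ v m))

  toℕ-label : ∀ v → toℕ (label v) ≡ level v m
  toℕ-label v = toℕ-fromℕ< (s≤s (level-≤ v m))

  ∈S⇒≤label : ∀ v {k} → k ≤ m → v ∈ S k → k ≤ toℕ (label v)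
  ∈S⇒≤label v k≤m v∈S = subst (_ ≤_) (sym (toℕ-label v)) (∈S⇒≤level v m k≤m v∈S)

  ≤label⇒∈S : ∀ v {k} → k ≤ toℕ (label v) → v ∈ S k
  ≤label⇒∈S v k≤label = S-antitone (subst (_ ≤_) (toℕ-label v) k≤label) (∈S-level v m)

  label-removedAt : ∀ v → RemovedAt v (label v)
  label-removedAt v = ≤label⇒∈S v ≤-refl , λ label<m v∈S → 1+n≰n (∈S⇒≤label v label<m v∈S)

  removedAt⇒label : ∀ {v} i → RemovedAt v i → label v ≡ i
  removedAt⇒label {v} i (v∈S , v∉S-suc) =
    toℕ-injective (≤-antisym label≤i (∈S⇒≤label v (toℕ≤pred[n] i) v∈S))
    where
    label≤i : toℕ (label v) ≤ toℕ i
    label≤i = ≮⇒≥ λ i<label →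
      v∉S-suc (<-≤-trans i<label (toℕ≤pred[n] (label v))) (≤label⇒∈S v i<label)

  label∘vertexAt : ∀ i → label (vertexAt i) ≡ i
  label∘vertexAt i = removedAt⇒label i (vertexAt-removedAt i)

  vertexAt∘label : ∀ v → vertexAt (label v) ≡ v
  vertexAt∘label v = sym (removedAt-unique (label v) (label-removedAt v))

  label-decreasing : ∀ w v → Child t w v → label w <ᶠ label v
  label-decreasing w v w-child = ≰⇒> λ label-v≤label-w →
    proj₂ v-leaf w (≤label⇒∈S w label-v≤label-w) w-child
    where
    v-leaf : LeafOf t (S (toℕ (label v))) v
    v-leaf = subst (LeafOf t (S (toℕ (label v)))) (vertexAt∘label v) (vertexAt-leaf (label v))

  labelling : Σ (Fin N → Fin N) (IsDecreasing t)
  labelling = label , inverseᵇ⇒bijective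
    ( strictlyInverseˡ⇒inverseˡ label label∘vertexAt
    , strictlyInverseʳ⇒inverseʳ label vertexAt∘label) , label-decreasing

  StageOrSingleton : Subset N → Set
  StageOrSingleton X = (∃[ k ] k ≤ m × X ≡ S k) ⊎ (∃[ v ] X ≡ ⁅ v ⁆)

  -- Descend along the chain while X stays inside it; where X first leaves S (suc k) ⊂ S k,
  -- compatibility with S (suc k) = S k - u forces X = S k, X = S (suc k) or X = ⁅ u ⁆.
  ∈τ⇒stageOrSingleton : ∀ {X} → X ∈ᴸ τ → StageOrSingleton X
  ∈τ⇒stageOrSingleton {X} X∈τ = descend m 0 (+-identityʳ m) (λ _ → ∈⊤)
    where
    X≠∅ : Nonempty X
    X≠∅ = proj₁ (tubes X X∈τ)

    descend : ∀ d k → d + k ≡ m → X ⊆ S k → StageOrSingleton X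
    descend zero    k refl X⊆S = inj₂ (element k , p⊆⁅x⁆⇒p≡⁅x⁆ X≠∅ λ x∈X →
      subst (_ ∈_) (lastStage≡⁅element⁆ k ≤-refl (n≮n k)) (X⊆S x∈X))
    descend (suc d) k d+k≡m X⊆S = compare (compatible X (S (suc k)) X∈τ (S∈τ (suc k)))
      where
      k<m : k < m
      k<m = subst (k <_) d+k≡m (s≤s (m≤n+m k d))
      open LeafRemoval (removal k k<m)

      compare : Compatible t X (S (suc k)) → StageOrSingleton X
      compare (inj₁ X⊆S-suc)        = descend d (suc k) (trans (+-suc d k) d+k≡m) X⊆S-suc
      compare (inj₂ (inj₁ S-suc⊆X)) = inj₁
        ([ (λ X≡S → k , <⇒≤ k<m , X≡S) , (λ X≡S-u → suc k , k<m , trans X≡S-u (sym remainder)) ]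
         (p-x⊆q⊆p⇒q≡p⊎q≡p-x (subst (_⊆ X) remainder S-suc⊆X) X⊆S))
      compare (inj₂ (inj₂ X∩S-suc≡∅)) = inj₂
        (vertex , q⊆p∧Empty[q∩p-x]⇒q≡⁅x⁆ X≠∅ X⊆S (subst (λ Y → Empty (X ∩ Y)) remainder X∩S-suc≡∅))

  IsLeafRemovalSequence : (ℕ → Subset N) → Set
  IsLeafRemovalSequence U =
    U 0 ≡ ⊤ × (∀ k → k < m → ∃[ u ] (LeafOf t (U k) u × U (suc k) ≡ U k - u × U (suc k) ∈ᴸ τ))

  S-unique : ∀ {U} → IsLeafRemovalSequence U → ∀ k → k ≤ m → S k ≡ U k
  S-unique (U0≡⊤ , _) zero _ = sym U0≡⊤
  S-unique {U} seq@(_ , next) (suc k) k<m with next k k<m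
  ... | u , u-leaf , U-suc≡U-u , U-suc∈τ = begin
    S (suc k)    ≡⟨ remainder ⟩
    S k - vertex ≡⟨ cong (S k -_) vertex≡u ⟩
    S k - u      ≡⟨ cong (_- u) Sk≡Uk ⟩
    U k - u      ≡⟨ sym U-suc≡U-u ⟩
    U (suc k)    ∎
    where
    open LeafRemoval (removal k k<m)
    open ≡-Reasoning

    Sk≡Uk : S k ≡ U k
    Sk≡Uk = S-unique seq k (<⇒≤ k<m)

    S-u∈τ : S k - u ∈ᴸ τ
    S-u∈τ = subst (_∈ᴸ τ) (trans U-suc≡U-u (cong (_- u) (sym Sk≡Uk))) U-suc∈τ

    vertex≡u : vertex ≡ u
    vertex≡u = leaf-unique t (proj₂ (tubes (S k) (S∈τ k)))
      (compatible _ _ (subst (_∈ᴸ τ) remainder (S∈τ (suc k))) S-u∈τ)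
      isLeaf (subst (λ X → LeafOf t X u) (sym Sk≡Uk) u-leaf)

  label-unique : ∀ {U} → IsLeafRemovalSequence U → ∀ {v} i →
                 v ∈ U (toℕ i) → (toℕ i < m → v ∉ U (suc (toℕ i))) → label v ≡ i
  label-unique seq {v} i v∈U v∉U-suc = removedAt⇒label i
    ( subst (v ∈_) (sym (S-unique seq _ (toℕ≤pred[n] i))) v∈U
    , λ i<m v∈S → v∉U-suc i<m (subst (v ∈_) (S-unique seq _ i<m) v∈S))

  superlevel-label≡S : ∀ k → k ≤ m → superlevel label k ≡ S k
  superlevel-label≡S k k≤m = ⊆-antisym (λ {v} v∈ → ≤label⇒∈S v (∈-superlevel⁻ v∈))
                                        (λ {v} v∈ → ∈-superlevel⁺ (∈S⇒≤label v k≤m v∈))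

  tubingOf-label⇒τ : ∀ {X} → X ∈ᴸ tubingOf label → X ∈ᴸ τ
  tubingOf-label⇒τ X∈ with ∈tubingOf⁻ X∈
  ... | inj₁ (k , k<N , refl) = subst (_∈ᴸ τ) (sym (superlevel-label≡S k (≤-pred k<N))) (S∈τ k)
  ... | inj₂ (v , refl)       = subst (λ u → ⁅ u ⁆ ∈ᴸ τ) (vertexAt∘label v) (⁅vertexAt⁆∈τ (label v))

  τ⇒tubingOf-label : ∀ {X} → X ∈ᴸ τ → X ∈ᴸ tubingOf label
  τ⇒tubingOf-label X∈τ with ∈τ⇒stageOrSingleton X∈τ
  ... | inj₁ (k , k≤m , refl) =
        subst (_∈ᴸ tubingOf label) (superlevel-label≡S k k≤m) (superlevel∈tubingOf (s≤s k≤m))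
  ... | inj₂ (v , refl)       = ⁅v⁆∈tubingOf v

module FromDecreasingLabelling {m : ℕ} (t : RootedTree (suc m)) (ℓ : Fin (suc m) → Fin (suc m))
                               (ℓ-decreasing : IsDecreasing t ℓ) where
  open RootedTree t

  N : ℕ
  N = suc m

  ℓ-injective : ∀ {v w} → ℓ v ≡ ℓ w → v ≡ w
  ℓ-injective = proj₁ (proj₁ ℓ-decreasing)

  labelled : ∀ k → k < N → Fin N
  labelled k k<N = proj₁ (proj₂ (proj₁ ℓ-decreasing) (fromℕ< k<N))

  toℕ-ℓ-labelled : ∀ k k<N → toℕ (ℓ (labelled k k<N)) ≡ k
  toℕ-ℓ-labelled k k<N =
    trans (cong toℕ (proj₂ (proj₂ (proj₁ ℓ-decreasing) (fromℕ< k<N)) refl)) (toℕ-fromℕ< k<N)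

  labelled-∈ : ∀ k k<N → labelled k k<N ∈ superlevel ℓ k
  labelled-∈ k k<N = ∈-superlevel⁺ (subst (k ≤_) (sym (toℕ-ℓ-labelled k k<N)) ≤-refl)

  labelled-∉ : ∀ k k<N → labelled k k<N ∉ superlevel ℓ (suc k)
  labelled-∉ k k<N w∈ = 1+n≰n (subst (suc k ≤_) (toℕ-ℓ-labelled k k<N) (∈-superlevel⁻ w∈))

  superlevel-zero : superlevel ℓ 0 ≡ ⊤
  superlevel-zero = ⊆-antisym (λ _ → ∈⊤) (λ _ → ∈-superlevel⁺ z≤n)

  superlevel-suc : ∀ k k<N → superlevel ℓ (suc k) ≡ superlevel ℓ k - labelled k k<N
  superlevel-suc k k<N = ⊆-antisym
    (λ v∈ → x∈p∧x≢y⇒x∈p-y (∈-superlevel⁺ (≤-trans (n≤1+n k) (∈-superlevel⁻ v∈)))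
                            λ { refl → labelled-∉ k k<N v∈ })
    λ {v} v∈ → ∈-superlevel⁺ (≤∧≢⇒< (∈-superlevel⁻ (p─q⊆p _ _ v∈)) λ k≡ℓv →
      x∈p-y⇒x≢y v∈ (ℓ-injective (toℕ-injective (trans (sym k≡ℓv) (sym (toℕ-ℓ-labelled k k<N))))))

  superlevel-last : superlevel ℓ m ≡ ⁅ labelled m ≤-refl ⁆
  superlevel-last = p⊆⁅x⁆⇒p≡⁅x⁆ (labelled m ≤-refl , labelled-∈ m ≤-refl) λ {v} v∈ →
    subst (_∈ ⁅ _ ⁆) (sym (ℓ-injective (toℕ-injective (trans
      (≤-antisym (toℕ≤pred[n] (ℓ v)) (∈-superlevel⁻ v∈)) (sym (toℕ-ℓ-labelled m ≤-refl))))))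
      (x∈⁅x⁆ _)

  superlevel-upClosed : ∀ k → UpClosed t (superlevel ℓ k)
  superlevel-upClosed k v v∈ v≢root =
    ∈-superlevel⁺ (≤-trans (∈-superlevel⁻ v∈) (<⇒≤ (proj₂ ℓ-decreasing v (parent v) (v≢root , refl))))

  labelled-leaf : ∀ k k<N → LeafOf t (superlevel ℓ k) (labelled k k<N)
  labelled-leaf k k<N = labelled-∈ k k<N , λ w w∈ w-child →
    1+n≰n (≤-trans (subst (suc (toℕ (ℓ w)) ≤_) (toℕ-ℓ-labelled k k<N) (proj₂ ℓ-decreasing w _ w-child))
                   (∈-superlevel⁻ w∈))

  superlevel-antitone : ∀ {j k} → j ≤ k → superlevel ℓ k ⊆ superlevel ℓ j
  superlevel-antitone j≤k v∈ = ∈-superlevel⁺ (≤-trans j≤k (∈-superlevel⁻ v∈))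

  tubingOf-tubes : ∀ X → X ∈ᴸ tubingOf ℓ → Tube t X
  tubingOf-tubes X X∈ with ∈tubingOf⁻ X∈
  ... | inj₁ (k , k<N , refl) =
        (labelled k k<N , labelled-∈ k k<N) , UpClosed⇒Connected t (superlevel-upClosed k)
  ... | inj₂ (v , refl)       = (v , x∈⁅x⁆ v) , ⁅x⁆-connected t v

  tubingOf-compatible : ∀ A B → A ∈ᴸ tubingOf ℓ → B ∈ᴸ tubingOf ℓ → Compatible t A B
  tubingOf-compatible A B A∈ B∈ with ∈tubingOf⁻ A∈ | ∈tubingOf⁻ B∈
  ... | inj₂ (x , refl) | _               = ⁅x⁆-compatible t x B
  ... | inj₁ _          | inj₂ (y , refl) = Compatible-sym t (⁅x⁆-compatible t y A)
  ... | inj₁ (j , _ , refl) | inj₁ (k , _ , refl) with ≤-total j k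
  ...   | inj₁ j≤k = inj₂ (inj₁ (superlevel-antitone j≤k))
  ...   | inj₂ k≤j = inj₁ (superlevel-antitone k≤j)

  tubingOf-view : ∀ {X} → X ∈ᴸ tubingOf ℓ → ∣ X ∣ ≡ 1 ⊎ ∃[ k ] k < m × X ≡ superlevel ℓ k
  tubingOf-view X∈ with ∈tubingOf⁻ X∈
  ... | inj₂ (v , refl) = inj₁ (∣⁅x⁆∣≡1 v)
  ... | inj₁ (k , k<N , refl) with m≤n⇒m<n∨m≡n (≤-pred k<N)
  ...   | inj₁ k<m  = inj₂ (k , k<m , refl)
  ...   | inj₂ refl = inj₁ (subst (λ X → ∣ X ∣ ≡ 1) (sym superlevel-last) (∣⁅x⁆∣≡1 (labelled m ≤-refl)))

  module _ {k} (k<m : k < m) where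

    k<N : k < N
    k<N = m<n⇒m<1+n k<m

    w : Fin N
    w = labelled k k<N

    w-leaf : LeafOf t (superlevel ℓ k) w
    w-leaf = labelled-leaf k k<N

    superlevel-k-w : superlevel ℓ k - w ≡ superlevel ℓ (suc k)
    superlevel-k-w = sym (superlevel-suc k k<N)

    ⁅w⁆≢superlevel : ⁅ w ⁆ ≢ superlevel ℓ k
    ⁅w⁆≢superlevel = y∈p∧y∉⁅x⁆⇒⁅x⁆≢p (superlevel-antitone (n≤1+n k) (labelled-∈ (suc k) (s≤s k<m)))
      λ w′∈⁅w⁆ → labelled-∉ k k<N
        (subst (_∈ superlevel ℓ (suc k)) (x∈⁅y⁆⇒x≡y w w′∈⁅w⁆) (labelled-∈ (suc k) (s≤s k<m)))

  tubingOf-binary : ∀ X → X ∈ᴸ tubingOf ℓ → (∣ X ∣ ≡ 1) ⊎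
    (∃[ A ] ∃[ B ] (A ∈ᴸ tubingOf ℓ × B ∈ᴸ tubingOf ℓ × A ≢ X × B ≢ X × PartitionedBy t X A B))
  tubingOf-binary X X∈ with tubingOf-view X∈
  ... | inj₁ ∣X∣≡1           = inj₁ ∣X∣≡1
  ... | inj₂ (k , k<m , refl) = inj₂
    ( ⁅ w k<m ⁆ , superlevel ℓ (suc k) , ⁅v⁆∈tubingOf _ , superlevel∈tubingOf (s≤s k<m)
    , ⁅w⁆≢superlevel k<m
    , (λ eq → x∈p⇒p-x≢p (proj₁ (w-leaf k<m)) (trans (superlevel-k-w k<m) eq))
    , subst (PartitionedBy t _ ⁅ w k<m ⁆) (superlevel-k-w k<m)
        (Empty[⁅x⁆∩p-x] _ (w k<m) , x∈p⇒⁅x⁆∪p-x≡p (proj₁ (w-leaf k<m))))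

  tubingOf-leafy : ∀ X → X ∈ᴸ tubingOf ℓ → ∣ X ∣ ≥ 2 →
                   ∃[ v ] (LeafOf t X v × ⁅ v ⁆ ∈ᴸ tubingOf ℓ × (X - v) ∈ᴸ tubingOf ℓ)
  tubingOf-leafy X X∈ 2≤∣X∣ with tubingOf-view X∈
  ... | inj₁ ∣X∣≡1           = contradiction (subst (2 ≤_) ∣X∣≡1 2≤∣X∣) λ { (s≤s ()) }
  ... | inj₂ (k , k<m , refl) = w k<m , w-leaf k<m , ⁅v⁆∈tubingOf _
    , subst (_∈ᴸ tubingOf ℓ) (sym (superlevel-k-w k<m)) (superlevel∈tubingOf (s≤s k<m))

  tubingOf-isLeafTubing : IsLeafTubing t (tubingOf ℓ)
  tubingOf-isLeafTubing = record
    { isBinary = record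
      { tubes      = tubingOf-tubes
      ; compatible = tubingOf-compatible
      ; hasV       = subst (_∈ᴸ tubingOf ℓ) superlevel-zero (superlevel∈tubingOf (s≤s z≤n))
      ; binary     = tubingOf-binary
      }
    ; leafy = tubingOf-leafy
    }

  open FromLeafTubing t (tubingOf ℓ) tubingOf-isLeafTubing
    using (IsLeafRemovalSequence; label; label-unique)

  superlevel-isLeafRemovalSequence : IsLeafRemovalSequence (superlevel ℓ)
  superlevel-isLeafRemovalSequence = superlevel-zero , λ k k<m →
    w k<m , w-leaf k<m , sym (superlevel-k-w k<m) , superlevel∈tubingOf (s≤s k<m)

  label-tubingOf : ∀ v → label v ≡ ℓ v
  label-tubingOf v = label-unique superlevel-isLeafRemovalSequence (ℓ v)
    (∈-superlevel⁺ ≤-refl) (λ _ v∈ → 1+n≰n (∈-superlevel⁻ v∈))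

module _ {m : ℕ} (t : RootedTree (suc m)) where
  open Setoid (LeafTubings t) using () renaming (Carrier to LeafTubing; _≈_ to _≈ᵗ_)
  open Setoid (DecreasingLabellings t) using () renaming (Carrier to DecreasingLabelling; _≈_ to _≈ˡ_)

  labellingOf : LeafTubing → DecreasingLabelling
  labellingOf (τ , τ-leaf) = FromLeafTubing.labelling t τ τ-leaf

  leafTubingOf : DecreasingLabelling → LeafTubing
  leafTubingOf (ℓ , ℓ-decreasing) =
    tubingOf ℓ , FromDecreasingLabelling.tubingOf-isLeafTubing t ℓ ℓ-decreasing

  labellingOf-cong : ∀ {x y} → x ≈ᵗ y → labellingOf x ≈ˡ labellingOf y
  labellingOf-cong {τ , τ-leaf} {τ′ , τ′-leaf} τ≈τ′ v =
    let v∈S′ , v∉S′-suc = B.label-removedAt v in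
    A.label-unique S′-isLeafRemovalSequence (B.label v) v∈S′ v∉S′-suc
    where
    module A = FromLeafTubing t τ τ-leaf
    module B = FromLeafTubing t τ′ τ′-leaf

    S′-isLeafRemovalSequence : A.IsLeafRemovalSequence B.S
    S′-isLeafRemovalSequence = refl , λ k k<m →
      let open B.LeafRemoval (B.removal k k<m) in
      vertex , isLeaf , remainder , proj₂ (τ≈τ′ _) (B.S∈τ (suc k))

  leafTubingOf-cong : ∀ {x y} → x ≈ˡ y → leafTubingOf x ≈ᵗ leafTubingOf y
  leafTubingOf-cong ℓ≗ℓ′ X rewrite tubingOf-cong ℓ≗ℓ′ = (λ X∈ → X∈) , (λ X∈ → X∈)

  labellingOf∘leafTubingOf : ∀ x → labellingOf (leafTubingOf x) ≈ˡ x
  labellingOf∘leafTubingOf (ℓ , ℓ-decreasing) = FromDecreasingLabelling.label-tubingOf t ℓ ℓ-decreasing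

  leafTubingOf∘labellingOf : ∀ x → leafTubingOf (labellingOf x) ≈ᵗ x
  leafTubingOf∘labellingOf (τ , τ-leaf) X = tubingOf-label⇒τ , τ⇒tubingOf-label
    where open FromLeafTubing t τ τ-leaf

  labellingOf-inverseˡ : Inverseˡ _≈ᵗ_ _≈ˡ_ labellingOf leafTubingOf
  labellingOf-inverseˡ {x} {y} y≈x′ v =
    trans (labellingOf-cong {y} {leafTubingOf x} y≈x′ v) (labellingOf∘leafTubingOf x v)

  labellingOf-inverseʳ : Inverseʳ _≈ᵗ_ _≈ˡ_ labellingOf leafTubingOf
  labellingOf-inverseʳ {x} {y} y≈x′ X =
    let y⇒x′ , x′⇒y = leafTubingOf-cong {y} {labellingOf x} y≈x′ X
        x′⇒x , x⇒x′ = leafTubingOf∘labellingOf x X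
    in (λ X∈ → x′⇒x (y⇒x′ X∈)) , (λ X∈ → x′⇒y (x⇒x′ X∈))

  leafTubings↔decreasingLabellings : Inverse (LeafTubings t) (DecreasingLabellings t)
  leafTubings↔decreasingLabellings = record
    { to        = labellingOf
    ; from      = leafTubingOf
    ; to-cong   = λ {x} {y} → labellingOf-cong {x} {y}
    ; from-cong = λ {x} {y} → leafTubingOf-cong {x} {y}
    ; inverse   = (λ {x} {y} → labellingOf-inverseˡ {x} {y}) , (λ {x} {y} → labellingOf-inverseʳ {x} {y})
    }

lemma3p1 : ∀ {n : ℕ} (t : RootedTree n) → Bijection (LeafTubings t) (DecreasingLabellings t)
lemma3p1 {zero}  t with RootedTree.root t
... | ()
lemma3p1 {suc m} t = Inverse⇒Bijection (leafTubings↔decreasingLabellings t)
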